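{- Let $(D,T,L)$ be a triple. Then for each leaf $x$ of $T$, $$\mathrm{ML}(D,T,L)=\max\{\mathrm{ML}(D,T,L\cup\{x\}),\ \mathrm{ML}(D,T\cup A^+_{\hat D(T,L)}(x),L)\}.$$
   Context: An out-tree of a digraph $D$ is a subgraph $T$ that is an oriented tree with exactly one vertex of in-degree zero (its root); its leaves are its vertices of out-degree zero in $T$ (a one-vertex out-tree has its root as its unique leaf); $\mathrm{Int}(T)$ is the set of non-leaf vertices of $T$. An out-branching is a spanning out-tree. A triple $(D,T,L)$ consists of a digraph $D$, an out-tree $T$ of $D$ and a set $L\subseteq V(D)\setminus\mathrm{Int}(T)$. A $(T,L)$-out-branching of $D$ is an out-branching $T'$ of $D$ with $A(T)\subseteq A(T')$, every vertex of $L$ a leaf of $T'$, and the same root as $T$; $\mathrm{ML}(D,T,L)$ is the maximum number of leaves of a $(T,L)$-out-branching of $D$, and $0$ if none exists. $\hat D(T,L)$ is the subgraph of $D$ obtained by deleting all arcs leaving vertices of $L$ and all arcs not in $A(T)$ whose head lies in $V(T)$. For a subgraph $H$, $A^+_H(x)$ is the set of arcs of $H$ leaving $x$; $T\cup F$ denotes the subgraph with arc set $A(T)\cup F$ and all incident vertices. -}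

module Defs where

open import Data.Nat using (ℕ; zero; suc; _+_; _≤_)
open import Data.Fin using (Fin; zero; suc; _≟_)
open import Data.Bool using (Bool; true; false; _∧_; _∨_; not; if_then_else_)
open import Data.Product using (Σ; _×_; _,_)
open import Data.Sum using (_⊎_)
open import Relation.Nullary using (¬_)
open import Relation.Nullary.Decidable using (⌊_⌋)
open import Relation.Binary.PropositionalEquality using (_≡_)
open import Relation.Binary.Construct.Closure.ReflexiveTransitive using (Star)

Digraph : ℕ → Set
Digraph n = Fin n → Fin n → Bool

VSet : ℕ → Set
VSet n = Fin n → Bool

record Subgraph (n : ℕ) : Set where
  constructor mkSub
  field
    V : VSet n
    A : Fin n → Fin n → Bool
open Subgraph public

anyFin : ∀ {n} → (Fin n → Bool) → Bool
anyFin {zero}  f = false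
anyFin {suc n} f = f zero ∨ anyFin (λ i → f (suc i))

count : ∀ {n} → (Fin n → Bool) → ℕ
count {zero}  f = 0
count {suc n} f = (if f zero then 1 else 0) + count (λ i → f (suc i))

IsSubgraphOf : ∀ {n} → Subgraph n → Digraph n → Set
IsSubgraphOf H D = ∀ u v → A H u v ≡ true →
  (D u v ≡ true) × (V H u ≡ true) × (V H v ≡ true)

IsOutTree : ∀ {n} → Digraph n → Subgraph n → Fin n → Set
IsOutTree {n} D T r =
  IsSubgraphOf T D ×
  (V T r ≡ true) ×
  (∀ u → A T u r ≡ false) ×
  (∀ v → V T v ≡ true → ¬ (v ≡ r) → Σ (Fin n) λ u → A T u v ≡ true) ×
  (∀ u u' v → A T u v ≡ true → A T u' v ≡ true → u ≡ u') ×
  (∀ v → V T v ≡ true → Star (λ a b → A T a b ≡ true) r v)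

IsLeaf : ∀ {n} → Subgraph n → Fin n → Set
IsLeaf H x = (V H x ≡ true) × (∀ w → A H x w ≡ false)

leafB : ∀ {n} → Subgraph n → Fin n → Bool
leafB H x = V H x ∧ not (anyFin (A H x))

numLeaves : ∀ {n} → Subgraph n → ℕ
numLeaves H = count (leafB H)

IsOutBranching : ∀ {n} → Digraph n → Subgraph n → Fin n → Set
IsOutBranching D T r = IsOutTree D T r × (∀ v → V T v ≡ true)

-- L ⊆ V(D) ∖ Int(T): no vertex of L has an out-arc in T.
AvoidsInt : ∀ {n} → Subgraph n → VSet n → Set
AvoidsInt T L = ∀ v → L v ≡ true → ∀ w → A T v w ≡ false

IsTLBranching : ∀ {n} → Digraph n → Subgraph n → Fin n → VSet n → Subgraph n → Set
IsTLBranching D T r L T' =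
  IsOutBranching D T' r ×
  (∀ u v → A T u v ≡ true → A T' u v ≡ true) ×
  (∀ v → L v ≡ true → IsLeaf T' v)

IsML : ∀ {n} → Digraph n → Subgraph n → Fin n → VSet n → ℕ → Set
IsML {n} D T r L m =
  (Σ (Subgraph n) λ T' → IsTLBranching D T r L T' × numLeaves T' ≡ m ×
     (∀ T'' → IsTLBranching D T r L T'' → numLeaves T'' ≤ m))
  ⊎ ((∀ T' → ¬ IsTLBranching D T r L T') × m ≡ 0)

_∪｛_｝ : ∀ {n} → VSet n → Fin n → VSet n
(L ∪｛ x ｝) v = L v ∨ ⌊ v ≟ x ⌋

-- D̂(T,L): delete arcs leaving L and arcs not in A(T) whose head is in V(T).
Dhat : ∀ {n} → Digraph n → Subgraph n → VSet n → Digraph n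
Dhat D T L u v = D u v ∧ not (L u) ∧ (A T u v ∨ not (V T v))

-- T ∪ A⁺_H(x): arcs of T plus arcs of H leaving x; vertices of T plus heads of these arcs.
extendAt : ∀ {n} → Subgraph n → Digraph n → Fin n → Subgraph n
extendAt T H x = mkSub (λ v → V T v ∨ H x v)
                       (λ u v → A T u v ∨ (⌊ u ≟ x ⌋ ∧ H u v))

-- Split the (T,L)-out-branchings T' according to whether the leaf x of T stays a leaf of T'.
-- If it does, T' is a (T, L ∪ {x})-out-branching. If not, make every out-neighbour of x in
-- D̂(T,L) a child of x: these vertices lie outside V(T), and x is reached from the root along
-- arcs of T, which are kept, so the result is a (T ∪ A⁺(x), L)-out-branching; the only vertex
-- that gains out-arcs is x, already a non-leaf of T', so no leaf is lost.
module Submission where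

open import Defs
open import Data.Nat using (ℕ; _⊔_; _≤_; z≤n; s≤s)
open import Data.Nat.Properties
  using (≤-refl; ≤-trans; n≤1+n; ≤-total; m≤m⊔n; m≤n⊔m; m≤n⇒m⊔n≡n; m≥n⇒m⊔n≡m; ⊔-identityʳ)
open import Data.Fin using (Fin; zero; suc; _≟_)
open import Data.Bool using (Bool; true; false; _∧_; _∨_; not)
open import Data.Bool.Properties
  using (∧-conicalˡ; ∧-conicalʳ; ∨-conicalˡ; ∨-conicalʳ; ∧-zeroʳ; ∨-zeroʳ; not-¬; ¬-not; not-injective)
open import Data.Product using (Σ; _×_; _,_; proj₁; proj₂)
open import Data.Sum using (_⊎_; inj₁; inj₂)
open import Data.Empty using (⊥; ⊥-elim)
open import Relation.Nullary using (¬_; yes)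
open import Relation.Nullary.Decidable using (⌊_⌋; isYes≗does; dec-true)
open import Relation.Binary.PropositionalEquality using (_≡_; refl; sym; trans; cong; cong₂)
open import Relation.Binary.Construct.Closure.ReflexiveTransitive using (Star; ε; _◅_; _◅◅_)
import Relation.Binary.Construct.Closure.ReflexiveTransitive as Star

∨≡true⇒⊎ : ∀ {a b} → a ∨ b ≡ true → a ≡ true ⊎ b ≡ true
∨≡true⇒⊎ {true}  _ = inj₁ refl
∨≡true⇒⊎ {false} p = inj₂ p

∨-introʳ : ∀ a {b} → b ≡ true → a ∨ b ≡ true
∨-introʳ a refl = ∨-zeroʳ a

true≢false : ∀ {a} → a ≡ true → a ≡ false → ⊥
true≢false p = not-¬ p

not≡true⇒≡false : ∀ {a} → not a ≡ true → a ≡ false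
not≡true⇒≡false = not-injective {y = false}

⌊≟⌋-refl : ∀ {n} (x : Fin n) → ⌊ x ≟ x ⌋ ≡ true
⌊≟⌋-refl x = trans (isYes≗does (x ≟ x)) (dec-true (x ≟ x) refl)

anyFin≡false⇒all : ∀ {n} (f : Fin n → Bool) → anyFin f ≡ false → ∀ i → f i ≡ false
anyFin≡false⇒all f p zero    = ∨-conicalˡ _ _ p
anyFin≡false⇒all f p (suc i) = anyFin≡false⇒all (λ j → f (suc j)) (∨-conicalʳ _ _ p) i

anyFin≡true⇒∃ : ∀ {n} (f : Fin n → Bool) → anyFin f ≡ true → Σ (Fin n) λ i → f i ≡ true
anyFin≡true⇒∃ {ℕ.suc n} f p with ∨≡true⇒⊎ {f zero} p
... | inj₁ f0 = zero , f0
... | inj₂ fs = let (i , fi) = anyFin≡true⇒∃ (λ j → f (suc j)) fs in suc i , fi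

∃⇒anyFin≡true : ∀ {n} (f : Fin n → Bool) i → f i ≡ true → anyFin f ≡ true
∃⇒anyFin≡true f zero    p = cong (_∨ anyFin (λ j → f (suc j))) p
∃⇒anyFin≡true f (suc i) p = ∨-introʳ (f zero) (∃⇒anyFin≡true (λ j → f (suc j)) i p)

count-mono : ∀ {n} (f g : Fin n → Bool) → (∀ i → f i ≡ true → g i ≡ true) → count f ≤ count g
count-mono {ℕ.zero} f g f⊆g = z≤n
count-mono {ℕ.suc n} f g f⊆g with f zero in f0 | g zero in g0
... | true  | true  = s≤s (count-mono _ _ (λ i → f⊆g (suc i)))
... | true  | false = ⊥-elim (true≢false (f⊆g zero f0) g0)
... | false | true  = ≤-trans (count-mono _ _ (λ i → f⊆g (suc i))) (n≤1+n _)
... | false | false = count-mono _ _ (λ i → f⊆g (suc i))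

-- IsML D T r L m unfolds to IsMaxOf (IsTLBranching D T r L) numLeaves m.
IsMaxOf : {A : Set} → (A → Set) → (A → ℕ) → ℕ → Set
IsMaxOf {A} P f m =
  (Σ A λ a → P a × f a ≡ m × (∀ b → P b → f b ≤ m)) ⊎ ((∀ a → ¬ P a) × m ≡ 0)

IsMaxOf-bound : ∀ {A : Set} {P : A → Set} {f m} → IsMaxOf P f m → ∀ {a} → P a → f a ≤ m
IsMaxOf-bound (inj₁ (_ , _ , _ , bound)) pa = bound _ pa
IsMaxOf-bound (inj₂ (empty , _))         pa = ⊥-elim (empty _ pa)

IsMaxOf-⊔ : ∀ {A : Set} {P P₁ P₂ : A → Set} {f : A → ℕ} {m₁ m₂} →
  (∀ a → P₁ a → P a) → (∀ a → P₂ a → P a) →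
  (∀ a → P a → Σ A λ b → (P₁ b ⊎ P₂ b) × f a ≤ f b) →
  IsMaxOf P₁ f m₁ → IsMaxOf P₂ f m₂ → IsMaxOf P f (m₁ ⊔ m₂)
IsMaxOf-⊔ {P = P} {P₁} {P₂} {f} {m₁} {m₂} P₁⊆P P₂⊆P dominated max₁ max₂ = attained max₁ max₂
  where
  bounded : ∀ a → P a → f a ≤ m₁ ⊔ m₂
  bounded a pa with dominated a pa
  ... | _ , inj₁ p₁ , fa≤fb = ≤-trans fa≤fb (≤-trans (IsMaxOf-bound max₁ p₁) (m≤m⊔n m₁ m₂))
  ... | _ , inj₂ p₂ , fa≤fb = ≤-trans fa≤fb (≤-trans (IsMaxOf-bound max₂ p₂) (m≤n⊔m m₁ m₂))

  empty : (∀ a → ¬ P₁ a) → (∀ a → ¬ P₂ a) → ∀ a → ¬ P a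
  empty none₁ none₂ a pa with dominated a pa
  ... | b , inj₁ p₁ , _ = none₁ b p₁
  ... | b , inj₂ p₂ , _ = none₂ b p₂

  attainedAt : ∀ a → P a → f a ≡ m₁ ⊔ m₂ → IsMaxOf P f (m₁ ⊔ m₂)
  attainedAt a pa fa≡m = inj₁ (a , pa , fa≡m , bounded)

  attained : IsMaxOf P₁ f m₁ → IsMaxOf P₂ f m₂ → IsMaxOf P f (m₁ ⊔ m₂)
  attained (inj₁ (a₁ , p₁ , fa₁ , _)) (inj₁ (a₂ , p₂ , fa₂ , _)) with ≤-total m₁ m₂
  ... | inj₁ m₁≤m₂ = attainedAt a₂ (P₂⊆P a₂ p₂) (trans fa₂ (sym (m≤n⇒m⊔n≡n m₁≤m₂)))
  ... | inj₂ m₂≤m₁ = attainedAt a₁ (P₁⊆P a₁ p₁) (trans fa₁ (sym (m≥n⇒m⊔n≡m m₂≤m₁)))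
  attained (inj₁ (a₁ , p₁ , fa₁ , _)) (inj₂ (_ , refl)) =
    attainedAt a₁ (P₁⊆P a₁ p₁) (trans fa₁ (sym (⊔-identityʳ m₁)))
  attained (inj₂ (_ , refl)) (inj₁ (a₂ , p₂ , fa₂ , _)) = attainedAt a₂ (P₂⊆P a₂ p₂) fa₂
  attained (inj₂ (none₁ , refl)) (inj₂ (none₂ , refl)) = inj₂ (empty none₁ none₂ , refl)

Arcs : ∀ {n} → Subgraph n → Fin n → Fin n → Set
Arcs H u v = A H u v ≡ true

module OutTree {n} {D : Digraph n} {T : Subgraph n} {r : Fin n} (t : IsOutTree D T r) where

  ⊆D : IsSubgraphOf T D
  ⊆D = proj₁ t

  root∈ : V T r ≡ true
  root∈ = proj₁ (proj₂ t)

  root-noParent : ∀ u → A T u r ≡ false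
  root-noParent = proj₁ (proj₂ (proj₂ t))

  parent : ∀ v → V T v ≡ true → ¬ (v ≡ r) → Σ (Fin n) λ u → Arcs T u v
  parent = proj₁ (proj₂ (proj₂ (proj₂ t)))

  parent-unique : ∀ u u' v → Arcs T u v → Arcs T u' v → u ≡ u'
  parent-unique = proj₁ (proj₂ (proj₂ (proj₂ (proj₂ t))))

  reach : ∀ v → V T v ≡ true → Star (Arcs T) r v
  reach = proj₂ (proj₂ (proj₂ (proj₂ (proj₂ t))))

leafB⇒IsLeaf : ∀ {n} (H : Subgraph n) v → leafB H v ≡ true → IsLeaf H v
leafB⇒IsLeaf H v p =
  ∧-conicalˡ _ _ p , anyFin≡false⇒all (A H v) (not≡true⇒≡false (∧-conicalʳ _ _ p))

IsLeaf⇒leafB : ∀ {n} (H : Subgraph n) v → IsLeaf H v → leafB H v ≡ true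
IsLeaf⇒leafB H v (v∈H , noArc) = cong₂ _∧_ v∈H (cong not (¬-not noOutArc))
  where
  noOutArc : ¬ (anyFin (A H v) ≡ true)
  noOutArc any = let (w , a) = anyFin≡true⇒∃ (A H v) any in true≢false a (noArc w)

numLeaves-mono : ∀ {n} (H H' : Subgraph n) → (∀ v → IsLeaf H v → IsLeaf H' v) →
  numLeaves H ≤ numLeaves H'
numLeaves-mono H H' leaves⊆ =
  count-mono _ _ (λ v p → IsLeaf⇒leafB H' v (leaves⊆ v (leafB⇒IsLeaf H v p)))

IsTLBranching-shrinkLeaves : ∀ {n} {D : Digraph n} {T : Subgraph n} {r} {L L' : VSet n} {T'} →
  (∀ v → L v ≡ true → L' v ≡ true) → IsTLBranching D T r L' T' → IsTLBranching D T r L T'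
IsTLBranching-shrinkLeaves L⊆L' (br , T⊆T' , L'-leaves) = br , T⊆T' , λ v Lv → L'-leaves v (L⊆L' v Lv)

IsTLBranching-shrinkTree : ∀ {n} {D : Digraph n} {T T₁ : Subgraph n} {r} {L : VSet n} {T'} →
  (∀ u v → Arcs T u v → Arcs T₁ u v) → IsTLBranching D T₁ r L T' → IsTLBranching D T r L T'
IsTLBranching-shrinkTree T⊆T₁ (br , T₁⊆T' , L-leaves) =
  br , (λ u v a → T₁⊆T' u v (T⊆T₁ u v a)) , L-leaves

IsTLBranching-addLeaf : ∀ {n} {D : Digraph n} {T : Subgraph n} {r} {L : VSet n} {T'} {x} →
  IsTLBranching D T r L T' → IsLeaf T' x → IsTLBranching D T r (L ∪｛ x ｝) T'
IsTLBranching-addLeaf {L = L} {T'} {x} (br , T⊆T' , L-leaves) x-leaf = br , T⊆T' , leaves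
  where
  leaves : ∀ v → (L ∪｛ x ｝) v ≡ true → IsLeaf T' v
  leaves v p with ∨≡true⇒⊎ {L v} p
  ... | inj₁ Lv = L-leaves v Lv
  ... | inj₂ _ with v ≟ x
  ...   | yes refl = x-leaf

rewire : ∀ {n} → Subgraph n → Digraph n → Fin n → Subgraph n
rewire T' H x = mkSub (V T') (λ u v → (⌊ u ≟ x ⌋ ∧ H u v) ∨ (A T' u v ∧ not (H x v)))

module Rewiring {n} {D : Digraph n} {T : Subgraph n} {r : Fin n} {L : VSet n}
  (tT : IsOutTree D T r) {x : Fin n} (x-leafT : IsLeaf T x)
  {T' : Subgraph n} (bT' : IsTLBranching D T r L T') {w₀ : Fin n} (x→w₀ : Arcs T' x w₀) where

  H : Digraph n
  H = Dhat D T L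

  R : Subgraph n
  R = rewire T' H x

  private
    module Tᵒ = OutTree tT
    module T'ᵒ = OutTree (proj₁ (proj₁ bT'))

    spanning : ∀ v → V T' v ≡ true
    spanning = proj₂ (proj₁ bT')

    T⊆T' : ∀ u v → Arcs T u v → Arcs T' u v
    T⊆T' = proj₁ (proj₂ bT')

  H-outside-T : ∀ v → V T v ≡ true → H x v ≡ false
  H-outside-T v v∈T rewrite proj₂ x-leafT v | v∈T =
    trans (cong (D x v ∧_) (∧-zeroʳ (not (L x)))) (∧-zeroʳ (D x v))

  arc-cases : ∀ {u v} → Arcs R u v → (u ≡ x × H x v ≡ true) ⊎ (Arcs T' u v × H x v ≡ false)
  arc-cases {u} {v} a with ∨≡true⇒⊎ {⌊ u ≟ x ⌋ ∧ H u v} a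
  ... | inj₂ kept = inj₂ (∧-conicalˡ _ _ kept , not≡true⇒≡false (∧-conicalʳ _ _ kept))
  ... | inj₁ new with u ≟ x
  ...   | yes refl = inj₁ (refl , new)

  arc-new : ∀ {v} → H x v ≡ true → Arcs R x v
  arc-new {v} h = cong (_∨ (A T' x v ∧ not (H x v))) (cong₂ _∧_ (⌊≟⌋-refl x) h)

  arc-kept : ∀ {u v} → Arcs T' u v → H x v ≡ false → Arcs R u v
  arc-kept {u} {v} a h = ∨-introʳ (⌊ u ≟ x ⌋ ∧ H u v) (cong₂ _∧_ a (cong not h))

  T⊆R : ∀ {u v} → Arcs T u v → Arcs R u v
  T⊆R a = arc-kept (T⊆T' _ _ a) (H-outside-T _ (proj₂ (proj₂ (Tᵒ.⊆D _ _ a))))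

  root⇝x : Star (Arcs R) r x
  root⇝x = Star.map T⊆R (Tᵒ.reach x (proj₁ x-leafT))

  arc-replaced : ∀ {u v} → Arcs T' u v → Arcs R x v ⊎ Arcs R u v
  arc-replaced {v = v} a = byHead (H x v) refl
    where
    byHead : ∀ b → H x v ≡ b → Arcs R x v ⊎ Arcs R _ v
    byHead true  h = inj₁ (arc-new h)
    byHead false h = inj₂ (arc-kept a h)

  reroute : ∀ {w v} → Star (Arcs R) r w → Star (Arcs T') w v → Star (Arcs R) r v
  reroute r⇝w ε = r⇝w
  reroute r⇝w (a ◅ w'⇝v) with arc-replaced a
  ... | inj₁ x→w' = reroute (root⇝x ◅◅ x→w' ◅ ε) w'⇝v
  ... | inj₂ w→w' = reroute (r⇝w ◅◅ w→w' ◅ ε) w'⇝v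

  isOutTree : IsOutTree D R r
  isOutTree = ⊆D , T'ᵒ.root∈ , root-noParent , parent , parent-unique , reach
    where
    ⊆D : IsSubgraphOf R D
    ⊆D u v a with arc-cases a
    ... | inj₁ (refl , h) = ∧-conicalˡ _ _ h , spanning u , spanning v
    ... | inj₂ (a' , _)   = T'ᵒ.⊆D u v a'

    root-noParent : ∀ u → A R u r ≡ false
    root-noParent u = ¬-not (λ a → noParent (arc-cases a))
      where
      noParent : (u ≡ x × H x r ≡ true) ⊎ (Arcs T' u r × H x r ≡ false) → ⊥
      noParent (inj₁ (_ , h)) = true≢false h (H-outside-T r Tᵒ.root∈)
      noParent (inj₂ (a , _)) = true≢false a (T'ᵒ.root-noParent u)

    parent : ∀ v → V R v ≡ true → ¬ (v ≡ r) → Σ (Fin n) λ u → Arcs R u v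
    parent v v∈ v≢r with T'ᵒ.parent v v∈ v≢r
    ... | u , a with arc-replaced a
    ...   | inj₁ x→v = x , x→v
    ...   | inj₂ u→v = u , u→v

    parent-unique : ∀ u u' v → Arcs R u v → Arcs R u' v → u ≡ u'
    parent-unique u u' v a a' with arc-cases a | arc-cases a'
    ... | inj₁ (u≡x , _) | inj₁ (u'≡x , _) = trans u≡x (sym u'≡x)
    ... | inj₁ (_ , h)   | inj₂ (_ , h')   = ⊥-elim (true≢false h h')
    ... | inj₂ (_ , h)   | inj₁ (_ , h')   = ⊥-elim (true≢false h' h)
    ... | inj₂ (b , _)   | inj₂ (b' , _)   = T'ᵒ.parent-unique u u' v b b'

    reach : ∀ v → V R v ≡ true → Star (Arcs R) r v
    reach v v∈ = reroute ε (T'ᵒ.reach v v∈)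

  leaf-preserved : ∀ {v} → IsLeaf T' v → IsLeaf R v
  leaf-preserved {v} (v∈ , noArc) = v∈ , λ w → ¬-not (λ a → noArcR (arc-cases a))
    where
    noArcR : ∀ {w} → (v ≡ x × H x w ≡ true) ⊎ (Arcs T' v w × H x w ≡ false) → ⊥
    noArcR (inj₁ (refl , _)) = true≢false x→w₀ (noArc w₀)
    noArcR (inj₂ (a , _))    = true≢false a (noArc _)

  isTLBranching : IsTLBranching D (extendAt T H x) r L R
  isTLBranching =
    (isOutTree , spanning) , extension⊆R , λ v Lv → leaf-preserved (proj₂ (proj₂ bT') v Lv)
    where
    extension⊆R : ∀ u v → Arcs (extendAt T H x) u v → Arcs R u v
    extension⊆R u v a with ∨≡true⇒⊎ {A T u v} a
    ... | inj₁ a∈T = T⊆R a∈T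
    ... | inj₂ new = cong (_∨ _) new

  moreLeaves : numLeaves T' ≤ numLeaves R
  moreLeaves = numLeaves-mono T' R (λ _ → leaf-preserved)

leaf-or-rewired : ∀ {n} {D : Digraph n} {T : Subgraph n} {r} {L : VSet n} {x} →
  IsOutTree D T r → IsLeaf T x → ∀ T' → IsTLBranching D T r L T' →
  Σ (Subgraph n) λ T'' →
    (IsTLBranching D T r (L ∪｛ x ｝) T'' ⊎ IsTLBranching D (extendAt T (Dhat D T L) x) r L T'') ×
    numLeaves T' ≤ numLeaves T''
leaf-or-rewired {D = D} {T} {r} {L} {x} tT x-leafT T' bT' with anyFin (A T' x) in any
... | false = T' , inj₁ (IsTLBranching-addLeaf {D = D} {T} {r} {x = x} bT' x-leafT') , ≤-refl
  where
  x-leafT' : IsLeaf T' x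
  x-leafT' = proj₂ (proj₁ bT') x , anyFin≡false⇒all (A T' x) any
... | true with anyFin≡true⇒∃ (A T' x) any
...   | _ , x→w = R , inj₂ isTLBranching , moreLeaves
  where open Rewiring tT x-leafT bT' x→w

lemma4 : ∀ {n} (D : Digraph n) (T : Subgraph n) (r : Fin n) (L : VSet n) →
    IsOutTree D T r → AvoidsInt T L →
    (x : Fin n) → IsLeaf T x →
    (m₁ m₂ : ℕ) →
    IsML D T r (L ∪｛ x ｝) m₁ →
    IsML D (extendAt T (Dhat D T L) x) r L m₂ →
    IsML D T r L (m₁ ⊔ m₂)
lemma4 D T r L tT _ x x-leafT m₁ m₂ =
  IsMaxOf-⊔ {P = IsTLBranching D T r L} without-x without-extension (leaf-or-rewired tT x-leafT)
  where
  without-x : ∀ T' → IsTLBranching D T r (L ∪｛ x ｝) T' → IsTLBranching D T r L T'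
  without-x _ = IsTLBranching-shrinkLeaves {D = D} {T} {r} (λ v Lv → cong (_∨ ⌊ v ≟ x ⌋) Lv)

  without-extension : ∀ T' → IsTLBranching D (extendAt T (Dhat D T L) x) r L T' →
    IsTLBranching D T r L T'
  without-extension _ =
    IsTLBranching-shrinkTree {D = D} {T} {extendAt T (Dhat D T L) x} {r}
      (λ u v a → cong (_∨ (⌊ u ≟ x ⌋ ∧ Dhat D T L u v)) a)
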